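{- If $FV(S\circ AB)$ is defined, then $FV(S\circ AB)=FV(S\circ A)\sqcup FV(S\circ B)$.
   Context: Variables $x,y,z,\ldots$; $\mathsf{x},\mathsf{y}$ range over variables. Terms and substitutions of $\lambda\alpha$: $A,B::=\mathsf{x}\mid AB\mid\lambda\mathsf{x}.A\mid S\circ A$, $S::=[B/\mathsf{x}]\mid W\mathsf{x}\mid\{\mathsf{y}\mathsf{x}\}\mid S_{\mathsf{x}}$; $S\circ AB$ means $S\circ(AB)$ and $S_1\circ S_2\circ A$ means $S_1\circ(S_2\circ A)$. A context is a pair $G,L$ of a finite set $G$ of variables and a finite list $L$ of variables with repetitions allowed; $\Gamma,\mathsf{x}$ denotes $G,(L,\mathsf{x})$; a context with empty list is written $G$. Free variables (partial): $FV(\mathsf{x})=\{\mathsf{x}\}$; $FV(AB)=FV(A)\sqcup FV(B)$; $FV(\lambda\mathsf{x}.A)=O_{\lambda\mathsf{x}}(FV(A))$; $FV(W\mathsf{x}\circ A)=FV(A),\mathsf{x}$; $FV([B/\mathsf{x}]\circ A)=FV((\lambda\mathsf{x}.A)B)$; $FV(\{\mathsf{y}\mathsf{x}\}\circ A)=FV(W\mathsf{y}\circ\lambda\mathsf{x}.A)$; $FV(S_{\mathsf{x}}\circ A)=FV(W\mathsf{x}\circ S\circ\lambda\mathsf{x}.A)$; where $O_{\lambda\mathsf{x}}(\Gamma,\mathsf{x})=\Gamma$, $O_{\lambda\mathsf{x}}(G)=G\setminus\{\mathsf{x}\}$, otherwise undefined; $(\Gamma,\mathsf{x})\sqcup(\Delta,\mathsf{x})=(\Gamma\sqcup\Delta),\mathsf{x}$,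 $(\Gamma,\mathsf{x})\sqcup G=(\Gamma\sqcup(G\setminus\{\mathsf{x}\})),\mathsf{x}$, $G\sqcup(\Gamma,\mathsf{x})=((G\setminus\{\mathsf{x}\})\sqcup\Gamma),\mathsf{x}$, $G_1\sqcup G_2=G_1\cup G_2$, otherwise undefined; anything built from an undefined value is undefined. -}

module Defs where

open import Data.Nat using (ℕ; _≟_)
open import Data.List using (List; []; _∷_; _++_; filter)
open import Data.Maybe using (Maybe; just; nothing; _>>=_; map)
open import Data.Product using (_×_; _,_)
open import Relation.Nullary using (yes; no; ¬_; does)
open import Relation.Nullary.Decidable using (¬?)
open import Relation.Binary.PropositionalEquality using (_≡_)
open import Data.List.Membership.Propositional using (_∈_)
open import Function.Bundles using (_⇔_)

Var : Set
Var = ℕ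

data Term : Set
data Sub  : Set

data Term where
  var  : Var → Term
  _·_  : Term → Term → Term
  lam  : Var → Term → Term
  _∘_  : Sub → Term → Term

data Sub where
  [_/_] : Term → Var → Sub
  W     : Var → Sub
  ｛_,_｝ : Var → Var → Sub            -- {y x}  (first arg y, second x)
  _ₛ_   : Sub → Var → Sub

infixl 7 _·_
infixr 5 _∘_

data SnocList : Set where
  ε   : SnocList
  _▸_ : SnocList → Var → SnocList

-- A context G,L: a finite set G (represented by a list, read up to
-- membership) and a list L of variables with repetitions allowed.
record Ctx : Set where
  constructor ⟨_∣_⟩
  field
    G : List Var
    L : SnocList
open Ctx public

_,,_ : Ctx → Var → Ctx
⟨ G ∣ L ⟩ ,, x = ⟨ G ∣ L ▸ x ⟩

_∖_ : List Var → Var → List Var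
G ∖ x = filter (λ y → ¬? (y ≟ x)) G

_∪_ : List Var → List Var → List Var
G₁ ∪ G₂ = G₁ ++ G₂

O : Var → Ctx → Maybe Ctx
O x ⟨ G ∣ ε ⟩ = just ⟨ G ∖ x ∣ ε ⟩
O x ⟨ G ∣ L ▸ y ⟩ with x ≟ y
... | yes _ = just ⟨ G ∣ L ⟩
... | no  _ = nothing

join : List Var → SnocList → List Var → SnocList → Maybe Ctx
join G₁ (L₁ ▸ x) G₂ (L₂ ▸ y) with x ≟ y
... | yes _ = map (_,, x) (join G₁ L₁ G₂ L₂)
... | no  _ = nothing
join G₁ (L₁ ▸ x) G₂ ε = map (_,, x) (join G₁ L₁ (G₂ ∖ x) ε)
join G₁ ε G₂ (L₂ ▸ y) = map (_,, y) (join (G₁ ∖ y) ε G₂ L₂)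
join G₁ ε G₂ ε = just ⟨ G₁ ∪ G₂ ∣ ε ⟩

_⊔_ : Ctx → Ctx → Maybe Ctx
⟨ G₁ ∣ L₁ ⟩ ⊔ ⟨ G₂ ∣ L₂ ⟩ = join G₁ L₁ G₂ L₂

_⊔?_ : Maybe Ctx → Maybe Ctx → Maybe Ctx
m₁ ⊔? m₂ = m₁ >>= λ Γ → m₂ >>= λ Δ → Γ ⊔ Δ

-- FV, partial.  fvS S Γ computes FV(S ∘ A) from Γ = FV(A); this is the
-- given definition unfolded so that it is structurally recursive:
--   FV([B/x]∘A) = FV((λx.A)B) = O_{λx}(FV A) ⊔ FV B
--   FV({y x}∘A) = FV(W y ∘ λx.A) = O_{λx}(FV A), y
--   FV(S_x ∘ A) = FV(W x ∘ S ∘ λx.A) = (FV(S ∘ λx.A)), x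
FV  : Term → Maybe Ctx
fvS : Sub → Ctx → Maybe Ctx

FV (var x)   = just ⟨ x ∷ [] ∣ ε ⟩
FV (A · B)   = FV A ⊔? FV B
FV (lam x A) = FV A >>= O x
FV (S ∘ A)   = FV A >>= fvS S

fvS [ B / x ] Γ = O x Γ ⊔? FV B
fvS (W x)     Γ = just (Γ ,, x)
fvS ｛ y , x ｝ Γ = map (_,, y) (O x Γ)
fvS (S ₛ x)   Γ = map (_,, x) (O x Γ >>= fvS S)

_≈_ : Ctx → Ctx → Set
Γ ≈ Δ = (∀ x → (x ∈ G Γ) ⇔ (x ∈ G Δ)) × (L Γ ≡ L Δ)

module Submission where

-- A context ⟨G ∣ L⟩ is looked at from a "viewpoint": a list N
-- that extends L downwards, N = P ⧺ L.  From N, a variable y is visible in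
-- the context when y ∈ G and y does not occur in the extension P
-- ('Vis N Γ y').  The partial join Γ ⊔ Δ is then characterised
-- semantically ('IsJoin Γ Δ Θ'): the list of Θ is the longer of the two
-- (comparable) lists, and from every viewpoint above it, what is visible in
-- Θ is exactly what is visible in Γ or in Δ.  We show that the function
-- 'join' is sound and complete for this relation, and that the relation
-- determines its result up to '≈'.  Each operation out of which 'fvS S' is
-- built preserves the relation: appending a variable, O_{λx} (which lowers
-- the viewpoint by one), and joining with a fixed context β (since
-- (Γ ⊔ Δ) ⊔ β = (Γ ⊔ β) ⊔ (Δ ⊔ β)).  By induction on S, 'fvS S' maps a join
-- to a join; applied to FV(AB) = FV A ⊔ FV B this gives the theorem.

open import Defs
open import Data.Empty using (⊥-elim)
open import Data.List.Membership.Propositional using (_∈_)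
open import Data.List.Membership.Propositional.Properties using (∈-++⁺ˡ; ∈-++⁺ʳ; ∈-++⁻; ∈-filter⁺; ∈-filter⁻)
open import Data.Maybe using (Maybe; just; _>>=_; map)
open import Data.Maybe.Properties using (map-just)
open import Data.Nat using (_≟_)
open import Data.Product using (Σ; _×_; _,_; proj₁)
open import Data.Sum using (_⊎_; inj₁; inj₂; swap) renaming (map to ⊎-map)
open import Data.Sum.Function.Propositional using (_⊎-⇔_)
open import Function.Bundles using (_⇔_; mk⇔)
open import Function.Construct.Identity using (⇔-id)
open import Function.Construct.Symmetry using (⇔-sym)
open import Function.Construct.Composition using (_⇔-∘_)
open import Function.Related.Propositional using (module EquationalReasoning; equivalence)
open import Relation.Nullary using (yes; no; ¬_)
open import Relation.Nullary.Decidable using (¬?)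
open import Relation.Binary.PropositionalEquality using (_≡_; refl; sym; trans; cong; subst)

open EquationalReasoning {k = equivalence}

_⧺_ : SnocList → SnocList → SnocList
P ⧺ ε       = P
P ⧺ (L ▸ x) = (P ⧺ L) ▸ x

⧺-identityˡ : ∀ L → ε ⧺ L ≡ L
⧺-identityˡ ε       = refl
⧺-identityˡ (L ▸ x) = cong (_▸ x) (⧺-identityˡ L)

⧺-assoc : ∀ P Q L → (P ⧺ Q) ⧺ L ≡ P ⧺ (Q ⧺ L)
⧺-assoc P Q ε       = refl
⧺-assoc P Q (L ▸ x) = cong (_▸ x) (⧺-assoc P Q L)

▸-injective : ∀ {L M x y} → L ▸ x ≡ M ▸ y → L ≡ M × x ≡ y
▸-injective refl = refl , refl

⧺-cancelʳ : ∀ P Q L → P ⧺ L ≡ Q ⧺ L → P ≡ Q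
⧺-cancelʳ P Q ε       e = e
⧺-cancelʳ P Q (L ▸ x) e = ⧺-cancelʳ P Q L (proj₁ (▸-injective e))

⧺-conicalʳ : ∀ P Q → P ⧺ Q ≡ ε → Q ≡ ε
⧺-conicalʳ P ε       e = refl
⧺-conicalʳ P (Q ▸ x) ()

infix 4 _⊑_
_⊑_ : SnocList → SnocList → Set
M ⊑ N = Σ SnocList λ P → N ≡ P ⧺ M

ε-⊑ : ∀ {N} → ε ⊑ N
ε-⊑ {N} = N , refl

⊑-refl : ∀ {L} → L ⊑ L
⊑-refl {L} = ε , sym (⧺-identityˡ L)

⊑-trans : ∀ {K M N} → K ⊑ M → M ⊑ N → K ⊑ N
⊑-trans {K} (P , refl) (Q , refl) = Q ⧺ P , sym (⧺-assoc Q P K)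

▸-⊑ : ∀ {M N x} → M ⊑ N → M ▸ x ⊑ N ▸ x
▸-⊑ (P , refl) = P , refl

⊑-antisym : ∀ {M N} → M ⊑ N → N ⊑ M → M ≡ N
⊑-antisym {M} (P , refl) (Q , e) = trans (sym (⧺-identityˡ M)) (cong (_⧺ M) (sym P≡ε))
  where
  QP≡ε : Q ⧺ P ≡ ε
  QP≡ε = ⧺-cancelʳ (Q ⧺ P) ε M (trans (⧺-assoc Q P M) (trans (sym e) (sym (⧺-identityˡ M))))
  P≡ε : P ≡ ε
  P≡ε = ⧺-conicalʳ Q P QP≡ε

⊑-squeeze : ∀ {K M N} → K ⊑ M → M ⊑ N → N ≡ K → N ≡ M
⊑-squeeze K⊑M M⊑N refl = ⊑-antisym K⊑M M⊑N

Comparable : SnocList → SnocList → Set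
Comparable M N = M ⊑ N ⊎ N ⊑ M

⊑-comparable : ∀ {K M N} → K ⊑ N → M ⊑ N → Comparable K M
⊑-comparable {ε}     _ _ = inj₁ ε-⊑
⊑-comparable {K ▸ x} {ε} _ _ = inj₂ ε-⊑
⊑-comparable {K ▸ x} {M ▸ y} (P , e₁) (Q , e₂) with ▸-injective (trans (sym e₁) e₂)
... | e , refl = ⊎-map ▸-⊑ ▸-⊑ (⊑-comparable (P , refl) (Q , e))

Comparable-▸ : ∀ {K M x y} → Comparable (K ▸ x) (M ▸ y) → x ≡ y × Comparable K M
Comparable-▸ (inj₁ (P , e)) with ▸-injective e
... | e′ , refl = refl , inj₁ (P , e′)
Comparable-▸ (inj₂ (P , e)) with ▸-injective e
... | e′ , refl = refl , inj₂ (P , e′)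

data _∈ₛ_ (y : Var) : SnocList → Set where
  here  : ∀ {L} → y ∈ₛ (L ▸ y)
  there : ∀ {L x} → y ∈ₛ L → y ∈ₛ (L ▸ x)

Vis : SnocList → Ctx → Var → Set
Vis N Γ y = Σ SnocList λ P → N ≡ P ⧺ L Γ × y ∈ G Γ × ¬ y ∈ₛ P

Vis-own : ∀ {N Γ y} → N ≡ L Γ → Vis N Γ y ⇔ y ∈ G Γ
Vis-own {Γ = Γ} refl = mk⇔ (λ (_ , _ , y∈G , _) → y∈G)
                           (λ y∈G → ε , sym (⧺-identityˡ (L Γ)) , y∈G , λ ())

Vis-snoc : ∀ {N Γ x y} → Vis (N ▸ x) (Γ ,, x) y ⇔ Vis N Γ y
Vis-snoc = mk⇔ (λ (P , e , y∈G , y∉P) → P , proj₁ (▸-injective e) , y∈G , y∉P)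
               (λ (P , e , y∈G , y∉P) → P , cong (_▸ _) e , y∈G , y∉P)

Vis-remove : ∀ {N G x y} → Vis (N ▸ x) ⟨ G ∣ ε ⟩ y ⇔ Vis N ⟨ G ∖ x ∣ ε ⟩ y
Vis-remove {N} {G} {x} {y} = mk⇔ to from
  where
  to : Vis (N ▸ x) ⟨ G ∣ ε ⟩ y → Vis N ⟨ G ∖ x ∣ ε ⟩ y
  to (_ , refl , y∈G , y∉N▸x) =
    N , refl , ∈-filter⁺ (λ z → ¬? (z ≟ x)) y∈G (λ { refl → y∉N▸x here }) , λ y∈N → y∉N▸x (there y∈N)
  from : Vis N ⟨ G ∖ x ∣ ε ⟩ y → Vis (N ▸ x) ⟨ G ∣ ε ⟩ y
  from (_ , refl , y∈G∖x , y∉N) with ∈-filter⁻ (λ z → ¬? (z ≟ x)) {xs = G} y∈G∖x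
  ... | y∈G , y≢x = N ▸ x , refl , y∈G , λ { here → y≢x refl ; (there y∈N) → y∉N y∈N }

Vis-∪ : ∀ {N G₁ G₂ L y} → Vis N ⟨ G₁ ∪ G₂ ∣ L ⟩ y ⇔ (Vis N ⟨ G₁ ∣ L ⟩ y ⊎ Vis N ⟨ G₂ ∣ L ⟩ y)
Vis-∪ {G₁ = G₁} = mk⇔ to from
  where
  to : ∀ {N G₂ L y} → Vis N ⟨ G₁ ∪ G₂ ∣ L ⟩ y → Vis N ⟨ G₁ ∣ L ⟩ y ⊎ Vis N ⟨ G₂ ∣ L ⟩ y
  to (P , e , y∈G , y∉P) with ∈-++⁻ G₁ y∈G
  ... | inj₁ y∈G₁ = inj₁ (P , e , y∈G₁ , y∉P)
  ... | inj₂ y∈G₂ = inj₂ (P , e , y∈G₂ , y∉P)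
  from : ∀ {N G₂ L y} → Vis N ⟨ G₁ ∣ L ⟩ y ⊎ Vis N ⟨ G₂ ∣ L ⟩ y → Vis N ⟨ G₁ ∪ G₂ ∣ L ⟩ y
  from (inj₁ (P , e , y∈G₁ , y∉P)) = P , e , ∈-++⁺ˡ y∈G₁ , y∉P
  from (inj₂ (P , e , y∈G₂ , y∉P)) = P , e , ∈-++⁺ʳ G₁ y∈G₂ , y∉P

record IsJoin (Γ Δ Θ : Ctx) : Set where
  field
    left  : L Γ ⊑ L Θ
    right : L Δ ⊑ L Θ
    top   : L Θ ≡ L Γ ⊎ L Θ ≡ L Δ
    view  : ∀ {N} → L Θ ⊑ N → ∀ y → Vis N Θ y ⇔ (Vis N Γ y ⊎ Vis N Δ y)
open IsJoin

IsJoin-swap : ∀ {Γ Δ Θ} → IsJoin Γ Δ Θ → IsJoin Δ Γ Θ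
IsJoin-swap J = record
  { left  = right J
  ; right = left J
  ; top   = swap (top J)
  ; view  = λ Θ⊑N y → mk⇔ swap swap ⇔-∘ view J Θ⊑N y
  }

IsJoin-least : ∀ {Γ Δ Θ M} → IsJoin Γ Δ Θ → L Γ ⊑ M → L Δ ⊑ M → L Θ ⊑ M
IsJoin-least J Γ⊑M Δ⊑M with top J
... | inj₁ e = subst (_⊑ _) (sym e) Γ⊑M
... | inj₂ e = subst (_⊑ _) (sym e) Δ⊑M

IsJoin-snoc : ∀ {Γ Δ Θ} x → IsJoin Γ Δ Θ → IsJoin (Γ ,, x) (Δ ,, x) (Θ ,, x)
IsJoin-snoc x J = record
  { left  = ▸-⊑ (left J)
  ; right = ▸-⊑ (right J)
  ; top   = ⊎-map (cong (_▸ x)) (cong (_▸ x)) (top J)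
  ; view  = λ { (P , refl) y → (⇔-sym Vis-snoc ⊎-⇔ ⇔-sym Vis-snoc) ⇔-∘ (view J (P , refl) y ⇔-∘ Vis-snoc) }
  }

IsJoin-lift : ∀ {Γ Θ G} x → IsJoin Γ ⟨ G ∖ x ∣ ε ⟩ Θ → IsJoin (Γ ,, x) ⟨ G ∣ ε ⟩ (Θ ,, x)
IsJoin-lift {Γ} {Θ} {G} x J = record
  { left  = ▸-⊑ (left J)
  ; right = ε-⊑
  ; top   = inj₁ (cong (_▸ x) Θ≡Γ)
  ; view  = view′
  }
  where
  Θ≡Γ : L Θ ≡ L Γ
  Θ≡Γ with top J
  ... | inj₁ e = e
  ... | inj₂ e = ⊑-squeeze ε-⊑ (left J) e
  view′ : ∀ {N} → L Θ ▸ x ⊑ N → ∀ y → Vis N (Θ ,, x) y ⇔ (Vis N (Γ ,, x) y ⊎ Vis N ⟨ G ∣ ε ⟩ y)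
  view′ (P , refl) y = begin
    Vis ((P ⧺ L Θ) ▸ x) (Θ ,, x) y                                     ∼⟨ Vis-snoc ⟩
    Vis (P ⧺ L Θ) Θ y                                                  ∼⟨ view J (P , refl) y ⟩
    (Vis (P ⧺ L Θ) Γ y ⊎ Vis (P ⧺ L Θ) ⟨ G ∖ x ∣ ε ⟩ y)                ∼⟨ ⇔-sym Vis-snoc ⊎-⇔ ⇔-sym Vis-remove ⟩
    (Vis ((P ⧺ L Θ) ▸ x) (Γ ,, x) y ⊎ Vis ((P ⧺ L Θ) ▸ x) ⟨ G ∣ ε ⟩ y) ∎

map-just⁻ : ∀ {f : Ctx → Ctx} {m b} → map f m ≡ just b → Σ Ctx λ a → m ≡ just a × f a ≡ b
map-just⁻ {m = just a} refl = a , refl , refl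

join-sound : ∀ G₁ L₁ G₂ L₂ {Θ} → join G₁ L₁ G₂ L₂ ≡ just Θ → IsJoin ⟨ G₁ ∣ L₁ ⟩ ⟨ G₂ ∣ L₂ ⟩ Θ
join-sound G₁ (L₁ ▸ x) G₂ (L₂ ▸ y) e with x ≟ y
join-sound G₁ (L₁ ▸ x) G₂ (L₂ ▸ y) e | yes refl with map-just⁻ {m = join G₁ L₁ G₂ L₂} e
... | _ , e₀ , refl = IsJoin-snoc x (join-sound G₁ L₁ G₂ L₂ e₀)
join-sound G₁ (L₁ ▸ x) G₂ (L₂ ▸ y) () | no _
join-sound G₁ (L₁ ▸ x) G₂ ε e with map-just⁻ {m = join G₁ L₁ (G₂ ∖ x) ε} e
... | _ , e₀ , refl = IsJoin-lift x (join-sound G₁ L₁ (G₂ ∖ x) ε e₀)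
join-sound G₁ ε G₂ (L₂ ▸ y) e with map-just⁻ {m = join (G₁ ∖ y) ε G₂ L₂} e
... | _ , e₀ , refl = IsJoin-swap (IsJoin-lift y (IsJoin-swap (join-sound (G₁ ∖ y) ε G₂ L₂ e₀)))
join-sound G₁ ε G₂ ε refl = record
  { left  = ⊑-refl
  ; right = ⊑-refl
  ; top   = inj₁ refl
  ; view  = λ _ y → Vis-∪
  }

join-complete : ∀ G₁ L₁ G₂ L₂ → Comparable L₁ L₂ → Σ Ctx λ Θ → join G₁ L₁ G₂ L₂ ≡ just Θ
join-complete G₁ (L₁ ▸ x) G₂ (L₂ ▸ y) c with x ≟ y | Comparable-▸ c
... | no x≢y   | x≡y , _ = ⊥-elim (x≢y x≡y)
... | yes refl | _ , c′ with join-complete G₁ L₁ G₂ L₂ c′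
...   | Θ , e = Θ ,, x , map-just e
join-complete G₁ (L₁ ▸ x) G₂ ε _ with join-complete G₁ L₁ (G₂ ∖ x) ε (inj₂ ε-⊑)
... | Θ , e = Θ ,, x , map-just e
join-complete G₁ ε G₂ (L₂ ▸ y) _ with join-complete (G₁ ∖ y) ε G₂ L₂ (inj₁ ε-⊑)
... | Θ , e = Θ ,, y , map-just e
join-complete G₁ ε G₂ ε _ = _ , refl

IsJoin-unique : ∀ {Γ Δ Ψ Θ} → IsJoin Γ Δ Ψ → IsJoin Γ Δ Θ → Ψ ≈ Θ
IsJoin-unique {Γ} {Δ} {Ψ} {Θ} J K = (λ y → same y) , Ψ≡Θ
  where
  Ψ≡Θ : L Ψ ≡ L Θ
  Ψ≡Θ = ⊑-antisym (IsJoin-least J (left K) (right K)) (IsJoin-least K (left J) (right J))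
  same : ∀ y → y ∈ G Ψ ⇔ y ∈ G Θ
  same y = begin
    y ∈ G Ψ                                    ∼⟨ ⇔-sym (Vis-own (sym Ψ≡Θ)) ⟩
    Vis (L Θ) Ψ y                              ∼⟨ view J (subst (_⊑ L Θ) (sym Ψ≡Θ) ⊑-refl) y ⟩
    (Vis (L Θ) Γ y ⊎ Vis (L Θ) Δ y)            ∼⟨ ⇔-sym (view K ⊑-refl y) ⟩
    Vis (L Θ) Θ y                              ∼⟨ Vis-own refl ⟩
    y ∈ G Θ                                    ∎

⊔-defined : ∀ {Γ Δ M} → L Γ ⊑ M → L Δ ⊑ M → Σ Ctx λ Θ → Γ ⊔ Δ ≡ just Θ × IsJoin Γ Δ Θ
⊔-defined {Γ} {Δ} Γ⊑M Δ⊑M with join-complete (G Γ) (L Γ) (G Δ) (L Δ) (⊑-comparable Γ⊑M Δ⊑M)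
... | Θ , e = Θ , e , join-sound (G Γ) (L Γ) (G Δ) (L Δ) e

IsJoin-⊔ : ∀ {Γ Δ Ψ} → IsJoin Γ Δ Ψ → Σ Ctx λ Θ → Γ ⊔ Δ ≡ just Θ × Ψ ≈ Θ
IsJoin-⊔ J with ⊔-defined (left J) (right J)
... | Θ , e , K = Θ , e , IsJoin-unique J K

O-hit : ∀ x G L → O x ⟨ G ∣ L ▸ x ⟩ ≡ just ⟨ G ∣ L ⟩
O-hit x G L with x ≟ x
... | yes _  = refl
... | no x≢x = ⊥-elim (x≢x refl)

-- O_{λx} is defined on Γ when its list is empty or ends in x.
O-defined : ∀ {Γ M} x → L Γ ⊑ M ▸ x → Σ Ctx λ Γ′ → O x Γ ≡ just Γ′ × L Γ′ ⊑ M
O-defined {⟨ G ∣ ε ⟩}     x _       = ⟨ G ∖ x ∣ ε ⟩ , refl , ε-⊑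
O-defined {⟨ G ∣ L ▸ z ⟩} x (P , e) with ▸-injective e
... | e′ , refl = ⟨ G ∣ L ⟩ , O-hit x G L , P , e′

O-⊑ : ∀ {Θ Θ′} x → O x Θ ≡ just Θ′ → L Θ ⊑ L Θ′ ▸ x
O-⊑ {⟨ H ∣ ε ⟩}     x refl = ε-⊑
O-⊑ {⟨ H ∣ M ▸ z ⟩} x e with x ≟ z
O-⊑ {⟨ H ∣ M ▸ z ⟩} x refl | yes refl = ⊑-refl
O-⊑ {⟨ H ∣ M ▸ z ⟩} x ()   | no _

O-list : ∀ {Γ Δ Γ′ Δ′} x → L Γ ≡ L Δ → O x Γ ≡ just Γ′ → O x Δ ≡ just Δ′ → L Γ′ ≡ L Δ′
O-list {⟨ G₁ ∣ ε ⟩}     {⟨ G₂ ∣ ε ⟩}     x refl refl refl = refl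
O-list {⟨ G₁ ∣ L ▸ z ⟩} {⟨ G₂ ∣ L ▸ z ⟩} x refl e₁ e₂ with x ≟ z
O-list {⟨ G₁ ∣ L ▸ z ⟩} {⟨ G₂ ∣ L ▸ z ⟩} x refl refl refl | yes _ = refl
O-list {⟨ G₁ ∣ L ▸ z ⟩} {⟨ G₂ ∣ L ▸ z ⟩} x refl () _    | no _

O-vis : ∀ {Γ Γ′} x → O x Γ ≡ just Γ′ → ∀ N y → Vis (N ▸ x) Γ y ⇔ Vis N Γ′ y
O-vis {⟨ G ∣ ε ⟩}     x refl N y = Vis-remove
O-vis {⟨ G ∣ L ▸ z ⟩} x e    N y with x ≟ z
O-vis {⟨ G ∣ L ▸ z ⟩} x refl N y | yes refl = Vis-snoc
O-vis {⟨ G ∣ L ▸ z ⟩} x ()   N y | no _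

IsJoin-O : ∀ {Γ Δ Θ Θ′} x → IsJoin Γ Δ Θ → O x Θ ≡ just Θ′ →
  Σ Ctx λ Γ′ → Σ Ctx λ Δ′ → O x Γ ≡ just Γ′ × O x Δ ≡ just Δ′ × IsJoin Γ′ Δ′ Θ′
IsJoin-O {Γ} {Δ} {Θ} {Θ′} x J oΘ
  with O-defined {Γ} x (⊑-trans (left J) (O-⊑ x oΘ)) | O-defined {Δ} x (⊑-trans (right J) (O-⊑ x oΘ))
... | Γ′ , oΓ , Γ′⊑ | Δ′ , oΔ , Δ′⊑ = Γ′ , Δ′ , oΓ , oΔ , record
  { left  = Γ′⊑
  ; right = Δ′⊑
  ; top   = ⊎-map (λ e → O-list x e oΘ oΓ) (λ e → O-list x e oΘ oΔ) (top J)
  ; view  = view′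
  }
  where
  view′ : ∀ {N} → L Θ′ ⊑ N → ∀ y → Vis N Θ′ y ⇔ (Vis N Γ′ y ⊎ Vis N Δ′ y)
  view′ {N} Θ′⊑N y = begin
    Vis N Θ′ y                              ∼⟨ ⇔-sym (O-vis x oΘ N y) ⟩
    Vis (N ▸ x) Θ y                         ∼⟨ view J (⊑-trans (O-⊑ x oΘ) (▸-⊑ Θ′⊑N)) y ⟩
    (Vis (N ▸ x) Γ y ⊎ Vis (N ▸ x) Δ y)     ∼⟨ O-vis x oΓ N y ⊎-⇔ O-vis x oΔ N y ⟩
    (Vis N Γ′ y ⊎ Vis N Δ′ y)               ∎

-- (a ∨ b) ∨ c ↔ (a ∨ c) ∨ (b ∨ c): the idempotent-distributive law behind
-- (Γ ⊔ Δ) ⊔ β = (Γ ⊔ β) ⊔ (Δ ⊔ β).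
⊎-distrib-self : ∀ {A B C : Set} → ((A ⊎ B) ⊎ C) ⇔ ((A ⊎ C) ⊎ (B ⊎ C))
⊎-distrib-self = mk⇔
  (λ { (inj₁ (inj₁ a)) → inj₁ (inj₁ a) ; (inj₁ (inj₂ b)) → inj₂ (inj₁ b) ; (inj₂ c) → inj₁ (inj₂ c) })
  (λ { (inj₁ (inj₁ a)) → inj₁ (inj₁ a) ; (inj₂ (inj₁ b)) → inj₁ (inj₂ b)
     ; (inj₁ (inj₂ c)) → inj₂ c ; (inj₂ (inj₂ c)) → inj₂ c })

IsJoin-distribʳ : ∀ {Γ Δ Θ β Φ} → IsJoin Γ Δ Θ → IsJoin Θ β Φ →
  Σ Ctx λ X → Σ Ctx λ Y → Γ ⊔ β ≡ just X × Δ ⊔ β ≡ just Y × IsJoin X Y Φ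
IsJoin-distribʳ {Γ} {Δ} {Θ} {β} {Φ} J K
  with ⊔-defined (⊑-trans (left J) (left K)) (right K) | ⊔-defined (⊑-trans (right J) (left K)) (right K)
... | X , eX , JX | Y , eY , JY = X , Y , eX , eY , record
  { left  = X⊑Φ
  ; right = Y⊑Φ
  ; top   = top′
  ; view  = view′
  }
  where
  X⊑Φ : L X ⊑ L Φ
  X⊑Φ = IsJoin-least JX (⊑-trans (left J) (left K)) (right K)
  Y⊑Φ : L Y ⊑ L Φ
  Y⊑Φ = IsJoin-least JY (⊑-trans (right J) (left K)) (right K)
  top′ : L Φ ≡ L X ⊎ L Φ ≡ L Y
  top′ with top K | top J
  ... | inj₂ Φ≡β | _        = inj₁ (⊑-squeeze (right JX) X⊑Φ Φ≡β)
  ... | inj₁ Φ≡Θ | inj₁ Θ≡Γ = inj₁ (⊑-squeeze (left JX) X⊑Φ (trans Φ≡Θ Θ≡Γ))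
  ... | inj₁ Φ≡Θ | inj₂ Θ≡Δ = inj₂ (⊑-squeeze (left JY) Y⊑Φ (trans Φ≡Θ Θ≡Δ))
  view′ : ∀ {N} → L Φ ⊑ N → ∀ y → Vis N Φ y ⇔ (Vis N X y ⊎ Vis N Y y)
  view′ {N} Φ⊑N y = begin
    Vis N Φ y                                               ∼⟨ view K Φ⊑N y ⟩
    (Vis N Θ y ⊎ Vis N β y)                                 ∼⟨ view J (⊑-trans (left K) Φ⊑N) y ⊎-⇔ ⇔-id _ ⟩
    ((Vis N Γ y ⊎ Vis N Δ y) ⊎ Vis N β y)                   ∼⟨ ⊎-distrib-self ⟩
    ((Vis N Γ y ⊎ Vis N β y) ⊎ (Vis N Δ y ⊎ Vis N β y))     ∼⟨ ⇔-sym (view JX (⊑-trans X⊑Φ Φ⊑N) y)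
                                                                 ⊎-⇔ ⇔-sym (view JY (⊑-trans Y⊑Φ Φ⊑N) y) ⟩
    (Vis N X y ⊎ Vis N Y y)                                 ∎

>>=-just⁻ : ∀ {B : Set} (m : Maybe Ctx) {f : Ctx → Maybe B} {b} → (m >>= f) ≡ just b →
  Σ Ctx λ a → m ≡ just a × f a ≡ just b
>>=-just⁻ (just a) e = a , refl , e

>>=-just⁺ : ∀ {B : Set} {m : Maybe Ctx} {f : Ctx → Maybe B} {a b} → m ≡ just a → f a ≡ just b → (m >>= f) ≡ just b
>>=-just⁺ refl e = e

fvS-join : ∀ S {Γ Δ Θ Φ} → IsJoin Γ Δ Θ → fvS S Θ ≡ just Φ →
  Σ Ctx λ Φ₁ → Σ Ctx λ Φ₂ → fvS S Γ ≡ just Φ₁ × fvS S Δ ≡ just Φ₂ × IsJoin Φ₁ Φ₂ Φ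
fvS-join (W x) {Γ} {Δ} J refl = Γ ,, x , Δ ,, x , refl , refl , IsJoin-snoc x J
fvS-join ｛ y , x ｝ {Θ = Θ} J e with map-just⁻ {m = O x Θ} e
... | Θ′ , oΘ , refl with IsJoin-O x J oΘ
...   | Γ′ , Δ′ , oΓ , oΔ , J′ = Γ′ ,, y , Δ′ ,, y , map-just oΓ , map-just oΔ , IsJoin-snoc y J′
fvS-join (S ₛ x) {Θ = Θ} J e with map-just⁻ {m = O x Θ >>= fvS S} e
... | _ , e′ , refl with >>=-just⁻ (O x Θ) e′
...   | Θ′ , oΘ , eS with IsJoin-O x J oΘ
...     | Γ′ , Δ′ , oΓ , oΔ , J′ with fvS-join S J′ eS
...       | Φ₁ , Φ₂ , e₁ , e₂ , J″ =
  Φ₁ ,, x , Φ₂ ,, x , map-just (>>=-just⁺ oΓ e₁) , map-just (>>=-just⁺ oΔ e₂) , IsJoin-snoc x J″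
fvS-join [ B / x ] {Θ = Θ} J e with >>=-just⁻ (O x Θ) e
... | Θ′ , oΘ , e′ with >>=-just⁻ (FV B) e′
...   | β , eB , j with IsJoin-O x J oΘ
...     | Γ′ , Δ′ , oΓ , oΔ , J′ with IsJoin-distribʳ J′ (join-sound _ _ _ _ j)
...       | X , Y , eX , eY , J″ = X , Y , >>=-just⁺ oΓ (>>=-just⁺ eB eX) , >>=-just⁺ oΔ (>>=-just⁺ eB eY) , J″

mainTheorem13 : (S : Sub) (A B : Term) (Γ : Ctx) →
    FV (S ∘ A · B) ≡ just Γ →
    Σ Ctx (λ Δ → (FV (S ∘ A) ⊔? FV (S ∘ B)) ≡ just Δ × Γ ≈ Δ)
mainTheorem13 S A B Γ e with >>=-just⁻ (FV (A · B)) e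
... | Θ , eAB , eS with >>=-just⁻ (FV A) eAB
... | ΓA , eA , eA⊔B with >>=-just⁻ (FV B) eA⊔B
... | ΓB , eB , eΘ with fvS-join S (join-sound _ _ _ _ eΘ) eS
... | ΦA , ΦB , eΦA , eΦB , J with IsJoin-⊔ J
... | Δ , eΔ , Γ≈Δ = Δ , >>=-just⁺ (>>=-just⁺ eA eΦA) (>>=-just⁺ (>>=-just⁺ eB eΦB) eΔ) , Γ≈Δ
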